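{- Let $M$ be a transversal matroid of rank $r$ on a finite set $E$, and let $\mathcal{A}=(A_i : i\in[r])$ be a presentation of $M$. Then the map $\sigma_\mathcal{A}:2^{[r]}\to 2^{[r]}$ is a closure operator on $[r]$ (i.e. $I\subseteq\sigma_\mathcal{A}(I)$; $I\subseteq J$ implies $\sigma_\mathcal{A}(I)\subseteq\sigma_\mathcal{A}(J)$; $\sigma_\mathcal{A}(\sigma_\mathcal{A}(I))=\sigma_\mathcal{A}(I)$). In the lattice $L_\mathcal{A}$ of $\sigma_\mathcal{A}$-closed sets (ordered by inclusion), the join is given by $I\lor J=I\cup J$ (and the meet by $I\land J=I\cap J$), so $L_\mathcal{A}$ is a distributive lattice. Moreover, both $\emptyset$ and $[r]$ belong to $L_\mathcal{A}$.
   Context: $[r]=\{1,\dots,r\}$. A set system $\mathcal{A}=(A_i:i\in[r])$ on a finite set $E$ is a sequence of subsets of $E$; a partial transversal of $\mathcal{A}$ is a set $X\subseteq E$ for which there is an injection $\phi:X\to[r]$ with $e\in A_{\phi(e)}$ for all $e\in X$. The partial transversals are the independent sets of a matroid $M[\mathcal{A}]$ on $E$; $\mathcal{A}$ is then called a presentation of $M[\mathcal{A}]$, and such matroids are transversal. Throughout, presentations of a rank-$r$ transversal matroid are taken to consist of exactly $r$ sets. Fix an element $x\notin E$. For $I\subseteq[r]$, let $\mathcal{A}^I=(A^I_i:i\in[r])$ where $A^I_i=A_i\cup\{x\}$ if $i\in I$ and $A^I_i=A_i$ otherwise; $M[\mathcal{A}^I]$ is a matroid on $E\cup\{x\}$.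 Define $\sigma_\mathcal{A}(I)=I\cup\{k\in[r]-I : x \text{ is a coloop of } M[\mathcal{A}^I]\backslash A_k\}$, where $\backslash A_k$ denotes deletion of the elements of $A_k$. (Equivalently, $\sigma_\mathcal{A}(I)$ is the largest $K\subseteq[r]$ with $M[\mathcal{A}^K]=M[\mathcal{A}^I]$.) A set $I$ is $\sigma_\mathcal{A}$-closed if $\sigma_\mathcal{A}(I)=I$, and $L_\mathcal{A}$ denotes the set of $\sigma_\mathcal{A}$-closed sets ordered by inclusion. -}

module Defs where

open import Data.Nat using (ℕ; suc)
open import Data.Fin using (Fin; zero; suc)
open import Data.Fin.Subset using (Subset; _∈_; _∉_; _⊆_; _∩_; _∪_; ∁; ⊤; ⊥; ∣_∣; inside; outside)
open import Data.Vec using (_∷_; lookup)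
open import Data.Product using (Σ; _×_)
open import Data.Sum using (_⊎_)
open import Function.Bundles using (_⇔_)
open import Relation.Binary.PropositionalEquality using (_≡_)

SetSystem : ℕ → ℕ → Set
SetSystem m r = Fin r → Subset m

IsPartialTransversal : ∀ {m r} → SetSystem m r → Subset m → Set
IsPartialTransversal {m} {r} A X =
  Σ ((e : Fin m) → e ∈ X → Fin r) λ φ →
    ((e : Fin m) (p : e ∈ X) → e ∈ A (φ e p)) ×
    ((e e′ : Fin m) (p : e ∈ X) (p′ : e′ ∈ X) → φ e p ≡ φ e′ p′ → e ≡ e′)

record SetMatroid (m : ℕ) : Set₁ where
  field
    ground : Subset m
    indep  : Subset m → Set
open SetMatroid public

M[_] : ∀ {m r} → SetSystem m r → SetMatroid m
M[ A ] = record { ground = ⊤ ; indep = IsPartialTransversal A }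

_＼_ : ∀ {m} → SetMatroid m → Subset m → SetMatroid m
N ＼ D = record
  { ground = ground N ∩ ∁ D
  ; indep  = λ X → indep N X × X ⊆ (ground N ∩ ∁ D) }

IsBasis : ∀ {m} → SetMatroid m → Subset m → Set
IsBasis N B = indep N B × B ⊆ ground N ×
  ((Y : Subset _) → indep N Y → B ⊆ Y → Y ⊆ B)

IsColoop : ∀ {m} → SetMatroid m → Fin m → Set
IsColoop N e = e ∈ ground N × ((B : Subset _) → IsBasis N B → e ∈ B)

-- Ground set E ∪ {x} is Fin (suc n): the new element x is `zero`,
-- and e ∈ E = Fin n corresponds to `suc e`.
xElt : ∀ {n} → Fin (suc n)
xElt = zero

lift : ∀ {n} → Subset n → Subset (suc n)
lift S = outside ∷ S

-- A^I : A^I_i = A_i ∪ {x} if i ∈ I, and A_i otherwise.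
ext : ∀ {n r} → SetSystem n r → Subset r → SetSystem (suc n) r
ext A I i = lookup I i ∷ A i

σ : ∀ {n r} → SetSystem n r → Subset r → Fin r → Set
σ A I k = k ∈ I ⊎ (k ∉ I × IsColoop (M[ ext A I ] ＼ lift (A k)) xElt)

IsSigmaOf : ∀ {n r} → SetSystem n r → Subset r → Subset r → Set
IsSigmaOf A I K = ∀ k → (k ∈ K ⇔ σ A I k)

Closed : ∀ {n r} → SetSystem n r → Subset r → Set
Closed A I = ∀ k → σ A I k → k ∈ I

-- M[A] has rank r: it has an independent set of size r
-- (partial transversals never have more than r elements).
HasRank : ∀ {n r} → SetSystem n r → ℕ → Set
HasRank A r = Σ (Subset _) λ X → IsPartialTransversal A X × ∣ X ∣ ≡ r

IsJoinIn : ∀ {n r} → SetSystem n r → Subset r → Subset r → Subset r → Set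
IsJoinIn A I J U = Closed A U × I ⊆ U × J ⊆ U ×
  ((K : Subset _) → Closed A K → I ⊆ K → J ⊆ K → U ⊆ K)

IsMeetIn : ∀ {n r} → SetSystem n r → Subset r → Subset r → Subset r → Set
IsMeetIn A I J W = Closed A W × W ⊆ I × W ⊆ J ×
  ((K : Subset _) → Closed A K → K ⊆ I → K ⊆ J → K ⊆ W)

module Submission where

-- Everything rests
-- on a combinatorial form of "x is a coloop of M[A^I]∖A_k" (Coloop I k):
-- for every maximal partial transversal B of A inside E ∖ A_k, the set
-- B ∪ {x} is a partial transversal of A^I.
-- Classical steps (excluded middle for the greedy choice) are carried
-- out in the double-negation monad; every conclusion about σ_A is
-- decidable or negative, hence stable, so nothing classical is assumed.

open import Defs
open import Level using (0ℓ)
open import Data.Nat using (ℕ; zero; suc; _+_; _≤_; _<_; s≤s)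
open import Data.Nat.Properties using (≤-trans; ≤-refl; <-≤-trans; +-suc; ≤-reflexive; m≤m+n; ≤-antisym; +-monoʳ-≤)
open import Data.Fin using (Fin; zero; suc; _≟_)
open import Data.Fin.Properties using (any?)
open import Data.Fin.Subset using (Subset; _∈_; _∉_; _⊆_; _∩_; _∪_; _─_; _-_; ∁; ⊤; ⊥; ⁅_⁆; ∣_∣; inside; outside)
open import Data.Fin.Subset.Properties using (_∈?_; drop-there; x∈p∪q⁻; x∈p∪q⁺; x∈p∩q⁻; x∈p∩q⁺; p⊆p∪q; q⊆p∪q; p∩q⊆p; p∩q⊆q; ∩-distribˡ-∪; x∈⁅y⁆⇒x≡y; x∈⁅x⁆; p─q⊆p; x∈p∧x≢y⇒x∈p-y; x∈p⇒∣p-x∣<∣p∣; p⊂q⇒∣p∣<∣q∣; ∣p∣≤n; ∣p∣≡n⇒p≡⊤; x∈∁p⇒x∉p; x∉p⇒x∈∁p; ∈⊤; ∉⊥)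
open import Data.Vec using (_∷_; _[_]=_; here; there)
open import Data.Vec.Properties using ([]=⇒lookup; lookup⇒[]=)
open import Data.Vec.Functional using (updateAt)
open import Data.Vec.Functional.Properties using (updateAt-updates; updateAt-minimal)
open import Data.Product using (Σ; ∃; _×_; _,_; proj₁; proj₂)
open import Data.Sum using (_⊎_; inj₁; inj₂; [_,_]; map; map₂)
open import Data.Unit using (tt) renaming (⊤ to Unit)
open import Data.Empty using (⊥-elim)
open import Effect.Monad using (RawMonad)
open import Function using (id; const)
open import Function.Bundles using (_⇔_; mk⇔; Equivalence)
open import Relation.Nullary using (¬_; Dec; yes; no)
open import Relation.Nullary.Decidable using (_×-dec_)
open import Relation.Nullary.Decidable.Core using (decidable-stable; ¬¬-excluded-middle)
open import Relation.Nullary.Negation using (DoubleNegation; ¬¬-Monad)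
open import Relation.Binary.PropositionalEquality using (_≡_; _≢_; refl; sym; trans; subst)

open RawMonad (¬¬-Monad {0ℓ}) using (pure; _>>=_)

x∈p─q⇒x∉q : ∀ {m} (p q : Subset m) {e} → e ∈ p ─ q → e ∉ q
x∈p─q⇒x∉q (_ ∷ p) (inside ∷ q) {zero} () _
x∈p─q⇒x∉q (_ ∷ p) (outside ∷ q) {zero} _ ()
x∈p─q⇒x∉q (_ ∷ p) (_ ∷ q) {suc e} (there e∈) (there e∈q) = x∈p─q⇒x∉q p q e∈ e∈q

module _ {m : ℕ} where

  ∈∪⁅⁆-case : ∀ {X : Subset m} {u e} → e ∈ X ∪ ⁅ u ⁆ → e ∈ X ⊎ e ≡ u
  ∈∪⁅⁆-case {X} {u} p = map₂ (x∈⁅y⁆⇒x≡y u) (x∈p∪q⁻ X ⁅ u ⁆ p)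

  ∈∪⁅⁆-old : ∀ {X : Subset m} {u e} → e ∈ X → e ∈ X ∪ ⁅ u ⁆
  ∈∪⁅⁆-old p = x∈p∪q⁺ (inj₁ p)

  ∈∪⁅⁆-new : ∀ {X : Subset m} {u e} → e ≡ u → e ∈ X ∪ ⁅ u ⁆
  ∈∪⁅⁆-new {u = u} refl = x∈p∪q⁺ (inj₂ (x∈⁅x⁆ u))

  ∪⁅⁆-⊆ : ∀ {B Y : Subset m} {e} → B ⊆ Y → e ∈ Y → B ∪ ⁅ e ⁆ ⊆ Y
  ∪⁅⁆-⊆ B⊆Y e∈Y p = [ B⊆Y , (λ { refl → e∈Y }) ] (∈∪⁅⁆-case p)

  ∈-⁻ : ∀ {X : Subset m} {t e} → e ∈ X - t → e ∈ X × e ≢ t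
  ∈-⁻ {X} {t} p = p─q⊆p X ⁅ t ⁆ p , λ { refl → x∈p─q⇒x∉q X ⁅ t ⁆ p (x∈⁅x⁆ t) }

  ∈-swap : ∀ {X : Subset m} {t e} → e ∈ X → e ∈ (X - t) ∪ ⁅ t ⁆
  ∈-swap {t = t} {e} e∈X with e ≟ t
  ... | yes e≡t = ∈∪⁅⁆-new e≡t
  ... | no e≢t = ∈∪⁅⁆-old (x∈p∧x≢y⇒x∈p-y e∈X e≢t)

  ⁅⁆⊆ : ∀ {I : Subset m} {j} → j ∈ I → ⁅ j ⁆ ⊆ I
  ⁅⁆⊆ {I} {j} j∈I p = subst (_∈ I) (sym (x∈⁅y⁆⇒x≡y j p)) j∈I

module _ {m r : ℕ} where

  pt-hereditary : ∀ {S : SetSystem m r} {X Y} → Y ⊆ X → IsPartialTransversal S X → IsPartialTransversal S Y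
  pt-hereditary Y⊆X (φ , fits , inj) =
    (λ e p → φ e (Y⊆X p)) , (λ e p → fits e (Y⊆X p)) , (λ e e′ p p′ → inj e e′ (Y⊆X p) (Y⊆X p′))

  pt-transfer : ∀ {S S′ : SetSystem m r} {X} → (∀ e i → e ∈ X → e ∈ S i → e ∈ S′ i) →
                IsPartialTransversal S X → IsPartialTransversal S′ X
  pt-transfer S⊆S′ (φ , fits , inj) = φ , (λ e p → S⊆S′ e (φ e p) p (fits e p)) , inj

  pt-∅ : ∀ {S : SetSystem m r} → IsPartialTransversal S ⊥
  pt-∅ = (λ _ p → ⊥-elim (∉⊥ p)) , (λ _ p → ⊥-elim (∉⊥ p)) , λ _ _ p → ⊥-elim (∉⊥ p)

-- A matching of X into S: a total map f choosing for each e ∈ X a set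
-- S (f e) containing it, injective on X, using only indices allowed by C.
-- Totality makes it easy to modify one value at a time.
record Matching {m r} (S : SetSystem m r) (X : Subset m) (C : Fin r → Set) (f : Fin m → Fin r) : Set where
  field
    fits      : ∀ e → e ∈ X → e ∈ S (f e)
    injective : ∀ e e′ → e ∈ X → e′ ∈ X → f e ≡ f e′ → e ≡ e′
    allowed   : ∀ e → e ∈ X → C (f e)
open Matching

Matchable : ∀ {m r} → SetSystem m r → Subset m → (Fin r → Set) → Set
Matchable {m} {r} S X C = Σ (Fin m → Fin r) (Matching S X C)

Unconstrained : ∀ {r} → Fin r → Set
Unconstrained _ = Unit

redirect : ∀ {m r} → (Fin m → Fin r) → Fin m → Fin r → Fin m → Fin r
redirect f u s = updateAt f u (const s)

module _ {m r : ℕ} {S : SetSystem m r} where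

  -- A partial transversal gives a matching; d is the value off X.
  pt⇒matching : ∀ {X} → Fin r → IsPartialTransversal S X → Matchable S X Unconstrained
  pt⇒matching {X} d (φ , fits′ , inj) = f , record { fits = fits″ ; injective = inj″ ; allowed = λ _ _ → tt }
    where
    choose : ∀ e → Dec (e ∈ X) → Fin r
    choose e (yes p) = φ e p
    choose e (no _) = d
    f : Fin m → Fin r
    f e = choose e (e ∈? X)
    fits-at : ∀ e (D : Dec (e ∈ X)) → e ∈ X → e ∈ S (choose e D)
    fits-at e (yes p) _ = fits′ e p
    fits-at e (no e∉X) p = ⊥-elim (e∉X p)
    fits″ : ∀ e → e ∈ X → e ∈ S (f e)
    fits″ e = fits-at e (e ∈? X)
    inj-at : ∀ e e′ (D : Dec (e ∈ X)) (D′ : Dec (e′ ∈ X)) → e ∈ X → e′ ∈ X → choose e D ≡ choose e′ D′ → e ≡ e′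
    inj-at e e′ (yes p) (yes p′) _ _ = inj e e′ p p′
    inj-at e e′ (no e∉X) _ p _ _ = ⊥-elim (e∉X p)
    inj-at e e′ (yes _) (no e′∉X) _ p′ _ = ⊥-elim (e′∉X p′)
    inj″ : ∀ e e′ → e ∈ X → e′ ∈ X → f e ≡ f e′ → e ≡ e′
    inj″ e e′ = inj-at e e′ (e ∈? X) (e′ ∈? X)

  matching⇒pt : ∀ {X C f} → Matching S X C f → IsPartialTransversal S X
  matching⇒pt {f = f} mf = (λ e _ → f e) , fits mf , injective mf

  restrict : ∀ {X Y C f} → Matching S X C f → Y ⊆ X → Matching S Y C f
  restrict mf Y⊆X = record
    { fits = λ e p → fits mf e (Y⊆X p)
    ; injective = λ e e′ p p′ → injective mf e e′ (Y⊆X p) (Y⊆X p′)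
    ; allowed = λ e p → allowed mf e (Y⊆X p) }

  constrain : ∀ {X C C′ f} → Matching S X C f → (∀ e → e ∈ X → C′ (f e)) → Matching S X C′ f
  constrain mf ok = record { fits = fits mf ; injective = injective mf ; allowed = ok }

  relax : ∀ {X C C′ f} → (∀ i → C i → C′ i) → Matching S X C f → Matching S X C′ f
  relax {f = f} C⊆C′ mf = constrain mf (λ e p → C⊆C′ (f e) (allowed mf e p))

  extend : ∀ {X C f u s} → Matching S X C f → u ∈ S s → C s → (∀ e → e ∈ X → f e ≢ s) →
           ∀ {Y} → (∀ e → e ∈ Y → e ≢ u → e ∈ X) → Matching S Y C (redirect f u s)
  extend {X} {C} {f} {u} {s} mf u∈s ok free {Y} Y⊆X+u = record { fits = fits′ ; injective = inj′ ; allowed = allowed′ }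
    where
    at-u : ∀ {e} → e ≡ u → redirect f u s e ≡ s
    at-u refl = updateAt-updates u f
    off-u : ∀ {e} → e ≢ u → redirect f u s e ≡ f e
    off-u {e} e≢u = updateAt-minimal e u f e≢u
    fits′ : ∀ e → e ∈ Y → e ∈ S (redirect f u s e)
    fits′ e p with e ≟ u
    ... | yes refl = subst (λ i → u ∈ S i) (sym (at-u refl)) u∈s
    ... | no e≢u = subst (λ i → e ∈ S i) (sym (off-u e≢u)) (fits mf e (Y⊆X+u e p e≢u))
    allowed′ : ∀ e → e ∈ Y → C (redirect f u s e)
    allowed′ e p with e ≟ u
    ... | yes e≡u = subst C (sym (at-u e≡u)) ok
    ... | no e≢u = subst C (sym (off-u e≢u)) (allowed mf e (Y⊆X+u e p e≢u))
    inj′ : ∀ e e′ → e ∈ Y → e′ ∈ Y → redirect f u s e ≡ redirect f u s e′ → e ≡ e′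
    inj′ e e′ p p′ eq with e ≟ u | e′ ≟ u
    ... | yes e≡u | yes e′≡u = trans e≡u (sym e′≡u)
    ... | yes e≡u | no e′≢u = ⊥-elim (free e′ (Y⊆X+u e′ p′ e′≢u) (trans (sym (off-u e′≢u)) (trans (sym eq) (at-u e≡u))))
    ... | no e≢u | yes e′≡u = ⊥-elim (free e (Y⊆X+u e p e≢u) (trans (sym (off-u e≢u)) (trans eq (at-u e′≡u))))
    ... | no e≢u | no e′≢u = injective mf e e′ (Y⊆X+u e p e≢u) (Y⊆X+u e′ p′ e′≢u)
                               (trans (sym (off-u e≢u)) (trans eq (off-u e′≢u)))

transfer : ∀ {m r} {S S′ : SetSystem m r} {X C f} →
           (∀ e → e ∈ X → C (f e) → e ∈ S (f e) → e ∈ S′ (f e)) → Matching S X C f → Matching S′ X C f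
transfer S⊆S′ mf = record
  { fits = λ e p → S⊆S′ e p (allowed mf e p) (fits mf e p) ; injective = injective mf ; allowed = allowed mf }

-- The exchange lemma

module Exchange {m r : ℕ} (S : SetSystem m r) where

  -- Given matchings of P and Q and u ∈ P ∖ Q: either Q ∪ {u} is
  -- matchable, or some t ∈ Q ∖ P can be swapped for u on both sides.
  Result : Subset m → Subset m → (Fin r → Set) → Fin m → Set
  Result P Q C u =
    Matchable S (Q ∪ ⁅ u ⁆) C ⊎
    Σ (Fin m) λ t → t ∈ Q × t ∉ P × Matchable S ((Q ∪ ⁅ u ⁆) - t) C × Matchable S ((P - u) ∪ ⁅ t ⁆) C

  -- One step of the alternating path from u, which follows f then g⁻¹.
  module Step {P Q : Subset m} {C : Fin r → Set} {f g : Fin m → Fin r}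
              (mf : Matching S P C f) (mg : Matching S Q C g)
              {u : Fin m} (u∈P : u ∈ P) (u∉Q : u ∉ Q) where

    unblocked : (∀ e → e ∈ Q → g e ≢ f u) → Result P Q C u
    unblocked free = inj₁ (redirect g u (f u) , extend mg (fits mf u u∈P) (allowed mf u u∈P) free
                             (λ e p e≢u → [ id , (λ e≡u → ⊥-elim (e≢u e≡u)) ] (∈∪⁅⁆-case p)))

    module Blocked {u₁ : Fin m} (u₁∈Q : u₁ ∈ Q) (gu₁≡fu : g u₁ ≡ f u) where

      u₁≢u : u₁ ≢ u
      u₁≢u refl = u∉Q u₁∈Q

      u₁∈S : u₁ ∈ S (f u)
      u₁∈S = subst (λ i → u₁ ∈ S i) gu₁≡fu (fits mg u₁ u₁∈Q)

      g-avoids : ∀ e → e ∈ Q - u₁ → g e ≢ f u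
      g-avoids e p eq = proj₂ (∈-⁻ p) (injective mg e u₁ (proj₁ (∈-⁻ p)) u₁∈Q (trans eq (sym gu₁≡fu)))

      f-avoids : ∀ e → e ∈ P - u → f e ≢ f u
      f-avoids e p eq = proj₂ (∈-⁻ p) (injective mf e u (proj₁ (∈-⁻ p)) u∈P eq)

      direct : u₁ ∉ P → Result P Q C u
      direct u₁∉P = inj₂ (u₁ , u₁∈Q , u₁∉P ,
        (redirect g u (f u) , extend (restrict mg (λ p → proj₁ (∈-⁻ p))) (fits mf u u∈P) (allowed mf u u∈P) g-avoids Q+u-u₁) ,
        (redirect f u₁ (f u) , extend (restrict mf (λ p → proj₁ (∈-⁻ p))) u₁∈S (allowed mf u u∈P) f-avoids P-u+u₁))
        where
        Q+u-u₁ : ∀ e → e ∈ (Q ∪ ⁅ u ⁆) - u₁ → e ≢ u → e ∈ Q - u₁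
        Q+u-u₁ e p e≢u = x∈p∧x≢y⇒x∈p-y ([ id , (λ e≡u → ⊥-elim (e≢u e≡u)) ] (∈∪⁅⁆-case (proj₁ (∈-⁻ p)))) (proj₂ (∈-⁻ p))
        P-u+u₁ : ∀ e → e ∈ (P - u) ∪ ⁅ u₁ ⁆ → e ≢ u₁ → e ∈ P - u
        P-u+u₁ e p e≢u₁ = [ id , (λ e≡u₁ → ⊥-elim (e≢u₁ e≡u₁)) ] (∈∪⁅⁆-case p)

      -- If u₁ ∈ P the path continues from u₁ with f u no longer available.
      Avoiding : Fin r → Set
      Avoiding i = C i × i ≢ f u

      mf′ : Matching S (P - u) Avoiding f
      mf′ = constrain (restrict mf (λ p → proj₁ (∈-⁻ p))) (λ e p → allowed mf e (proj₁ (∈-⁻ p)) , f-avoids e p)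

      mg′ : Matching S (Q - u₁) Avoiding g
      mg′ = constrain (restrict mg (λ p → proj₁ (∈-⁻ p))) (λ e p → allowed mg e (proj₁ (∈-⁻ p)) , g-avoids e p)

      prepend : Result (P - u) (Q - u₁) Avoiding u₁ → Result P Q C u
      prepend (inj₁ (h , mh)) =
        inj₁ (redirect h u (f u) , extend (relax (λ _ → proj₁) mh) (fits mf u u∈P) (allowed mf u u∈P)
                                     (λ e p → proj₂ (allowed mh e p)) Q+u)
        where
        Q+u : ∀ e → e ∈ Q ∪ ⁅ u ⁆ → e ≢ u → e ∈ (Q - u₁) ∪ ⁅ u₁ ⁆
        Q+u e p e≢u = [ ∈-swap , (λ e≡u → ⊥-elim (e≢u e≡u)) ] (∈∪⁅⁆-case p)
      prepend (inj₂ (t , t∈Q-u₁ , t∉P-u , (h , mh) , (h′ , mh′))) =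
        inj₂ (t , t∈Q , t∉P ,
          (redirect h u (f u) , extend (relax (λ _ → proj₁) mh) (fits mf u u∈P) (allowed mf u u∈P)
                                   (λ e p → proj₂ (allowed mh e p)) Q+u-t) ,
          (redirect h′ u₁ (f u) , extend (relax (λ _ → proj₁) mh′) u₁∈S (allowed mf u u∈P)
                                     (λ e p → proj₂ (allowed mh′ e p)) P-u+t))
        where
        t∈Q : t ∈ Q
        t∈Q = proj₁ (∈-⁻ t∈Q-u₁)
        t∉P : t ∉ P
        t∉P t∈P = t∉P-u (x∈p∧x≢y⇒x∈p-y t∈P (λ { refl → u∉Q t∈Q }))
        Q+u-t : ∀ e → e ∈ (Q ∪ ⁅ u ⁆) - t → e ≢ u → e ∈ ((Q - u₁) ∪ ⁅ u₁ ⁆) - t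
        Q+u-t e p e≢u = x∈p∧x≢y⇒x∈p-y ([ ∈-swap , (λ e≡u → ⊥-elim (e≢u e≡u)) ] (∈∪⁅⁆-case (proj₁ (∈-⁻ p)))) (proj₂ (∈-⁻ p))
        P-u+t : ∀ e → e ∈ (P - u) ∪ ⁅ t ⁆ → e ≢ u₁ → e ∈ ((P - u) - u₁) ∪ ⁅ t ⁆
        P-u+t e p e≢u₁ = [ (λ q → ∈∪⁅⁆-old (x∈p∧x≢y⇒x∈p-y q e≢u₁)) , ∈∪⁅⁆-new ] (∈∪⁅⁆-case p)

  -- The path shortens P each step, so induction on a bound for ∣ P ∣.
  exchange : ∀ F {P Q C f g} → ∣ P ∣ < F → Matching S P C f → Matching S Q C g →
             ∀ {u} → u ∈ P → u ∉ Q → Result P Q C u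
  exchange (suc F) {P} {Q} {f = f} {g} (s≤s ∣P∣≤F) mf mg {u} u∈P u∉Q
    with any? (λ q → (q ∈? Q) ×-dec (g q ≟ f u))
  ... | no none = unblocked (λ e e∈Q eq → none (e , e∈Q , eq))
    where open Step mf mg u∈P u∉Q
  ... | yes (u₁ , u₁∈Q , gu₁≡fu) with u₁ ∈? P
  ...   | no u₁∉P = direct u₁∉P
    where open Step mf mg u∈P u∉Q
          open Blocked u₁∈Q gu₁≡fu
  ...   | yes u₁∈P = prepend (exchange F (<-≤-trans (x∈p⇒∣p-x∣<∣p∣ u∈P) ∣P∣≤F) mf′ mg′
                                (x∈p∧x≢y⇒x∈p-y u₁∈P u₁≢u) (λ p → proj₂ (∈-⁻ p) refl))
    where open Step mf mg u∈P u∉Q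
          open Blocked u₁∈Q gu₁≡fu

MaximalIn : ∀ {m r} → SetSystem m r → Subset m → Subset m → Set
MaximalIn S X B = IsPartialTransversal S B × B ⊆ X ×
  (∀ e → e ∈ X → e ∉ B → ¬ IsPartialTransversal S (B ∪ ⁅ e ⁆))

module _ {m r : ℕ} (S : SetSystem m r) (X : Subset m) where

  -- Greedy augmentation: every partial transversal B ⊆ X lies in a
  -- maximal one (classically; F bounds the number of missing elements).
  maximal-extension : ∀ F B → m ≤ F + ∣ B ∣ → IsPartialTransversal S B → B ⊆ X →
                      DoubleNegation (Σ (Subset m) λ B′ → B ⊆ B′ × MaximalIn S X B′)
  maximal-extension zero B m≤∣B∣ ptB B⊆X = pure (B , (λ {_} p → p) , ptB , (λ {_} → B⊆X) , λ e _ e∉B _ → e∉B (B-full e))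
    where
    B-full : ∀ e → e ∈ B
    B-full e = subst (e ∈_) (sym (∣p∣≡n⇒p≡⊤ (≤-antisym (∣p∣≤n B) m≤∣B∣))) ∈⊤
  maximal-extension (suc F) B m≤F+∣B∣ ptB B⊆X = ¬¬-excluded-middle >>= grow
    where
    Augmentable : Set
    Augmentable = ∃ λ e → e ∈ X × e ∉ B × IsPartialTransversal S (B ∪ ⁅ e ⁆)
    grow : Dec Augmentable → DoubleNegation (Σ (Subset m) λ B′ → B ⊆ B′ × MaximalIn S X B′)
    grow (no stuck) = pure (B , (λ {_} p → p) , ptB , (λ {_} → B⊆X) , λ e e∈X e∉B pt → stuck (e , e∈X , e∉B , pt))
    grow (yes (e , e∈X , e∉B , pt)) =
      maximal-extension F (B ∪ ⁅ e ⁆) bound pt (∪⁅⁆-⊆ B⊆X e∈X) >>= λ { (B′ , B+e⊆B′ , maxB′) →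
      pure (B′ , (λ {_} p → B+e⊆B′ (∈∪⁅⁆-old p)) , maxB′) }
      where
      bound : m ≤ F + ∣ B ∪ ⁅ e ⁆ ∣
      bound = ≤-trans m≤F+∣B∣ (≤-trans (≤-reflexive (sym (+-suc F ∣ B ∣)))
                (+-monoʳ-≤ F (p⊂q⇒∣p∣<∣q∣ (∈∪⁅⁆-old , e , ∈∪⁅⁆-new refl , e∉B))))

  -- All maximal partial transversals inside X extend by an element y
  -- outside X in the same way (they are bases of the restriction to X).
  maximal-extends-alike : ∀ {B₁ B₂ y} → y ∉ X → MaximalIn S X B₁ → MaximalIn S X B₂ →
                          IsPartialTransversal S (B₁ ∪ ⁅ y ⁆) → IsPartialTransversal S (B₂ ∪ ⁅ y ⁆)
  maximal-extends-alike {B₁} {B₂} {y} y∉X (_ , B₁⊆X , maxB₁) (ptB₂ , B₂⊆X , _) pt@(φ , _) =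
    conclude (exchange (suc ∣ B₁ ∪ ⁅ y ⁆ ∣) ≤-refl (proj₂ (pt⇒matching d pt)) (proj₂ (pt⇒matching d ptB₂))
                       (∈∪⁅⁆-new refl) (λ p → y∉X (B₂⊆X p)))
    where
    open Exchange S using (Result; exchange)
    d : Fin r
    d = φ y (∈∪⁅⁆-new refl)
    -- A swap would augment B₁ inside X, contradicting maximality.
    conclude : Result (B₁ ∪ ⁅ y ⁆) B₂ Unconstrained y → IsPartialTransversal S (B₂ ∪ ⁅ y ⁆)
    conclude (inj₁ (_ , mh)) = matching⇒pt mh
    conclude (inj₂ (t , t∈B₂ , t∉B₁+y , _ , (_ , mh′))) =
      ⊥-elim (maxB₁ t (B₂⊆X t∈B₂) (λ p → t∉B₁+y (∈∪⁅⁆-old p)) (matching⇒pt (restrict mh′ B₁+t)))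
      where
      B₁+t : B₁ ∪ ⁅ t ⁆ ⊆ ((B₁ ∪ ⁅ y ⁆) - y) ∪ ⁅ t ⁆
      B₁+t p = [ (λ q → ∈∪⁅⁆-old (x∈p∧x≢y⇒x∈p-y (∈∪⁅⁆-old q) (λ { refl → y∉X (B₁⊆X q) }))) , ∈∪⁅⁆-new ]
                 (∈∪⁅⁆-case p)

-- x as a coloop of M[A^I] ∖ A_k

module Coloops {n r : ℕ} (A : SetSystem n r) where

  Indep : Subset r → Subset (suc n) → Set
  Indep I = IsPartialTransversal (ext A I)

  Rest : Fin r → Subset (suc n)
  Rest k = outside ∷ (⊤ ∩ ∁ (A k))

  -- Combinatorial form of "x is a coloop of M[A^I] ∖ A_k" (see
  -- coloop⇒Coloop and Coloop⇒coloop): every maximal partial transversal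
  -- of A inside E ∖ A_k stays independent in A^I when x is added.
  Coloop : Subset r → Fin r → Set
  Coloop I k = ∀ B → MaximalIn (ext A ⊥) (Rest k) B → DoubleNegation (Indep I (B ∪ ⁅ zero ⁆))

  -- Coloop is stable under double negation (it is a Π of negations).
  Coloop-stable : ∀ {I k} → DoubleNegation (Coloop I k) → Coloop I k
  Coloop-stable ¬¬c B maxB ¬indep = ¬¬c (λ c → c B maxB ¬indep)

  x∈A^I⇒ : ∀ I {i} → zero ∈ ext A I i → i ∈ I
  x∈A^I⇒ I {i} p = lookup⇒[]= i I ([]=⇒lookup p)

  x∈A^I⇐ : ∀ {I i} → i ∈ I → zero ∈ ext A I i
  x∈A^I⇐ {I} {i} p = subst (λ b → (b ∷ A i) [ zero ]= inside) (sym ([]=⇒lookup p)) here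

  A^-mono : ∀ {I J} → I ⊆ J → ∀ e i → e ∈ ext A I i → e ∈ ext A J i
  A^-mono {I} I⊆J zero i p = x∈A^I⇐ (I⊆J (x∈A^I⇒ I p))
  A^-mono I⊆J (suc e) i p = there (drop-there p)

  A^-off-x : ∀ I J {Y : Subset (suc n)} → zero ∉ Y → ∀ e i → e ∈ Y → e ∈ ext A I i → e ∈ ext A J i
  A^-off-x _ _ x∉Y zero _ x∈Y _ = ⊥-elim (x∉Y x∈Y)
  A^-off-x _ _ _ (suc e) _ _ p = there (drop-there p)

  A^-off-k : ∀ I {k} e i → i ≢ k → e ∈ ext A (I ∪ ⁅ k ⁆) i → e ∈ ext A I i
  A^-off-k I {k} zero i i≢k p = [ x∈A^I⇐ , (λ i≡k → ⊥-elim (i≢k i≡k)) ] (∈∪⁅⁆-case (x∈A^I⇒ (I ∪ ⁅ k ⁆) p))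
  A^-off-k _ (suc e) i _ p = there (drop-there p)

  indep-mono : ∀ {I J Y} → I ⊆ J → Indep I Y → Indep J Y
  indep-mono I⊆J = pt-transfer (λ e i _ → A^-mono I⊆J e i)

  indep-without-x : ∀ I J {Y} → zero ∉ Y → Indep I Y → Indep J Y
  indep-without-x I J x∉Y = pt-transfer (A^-off-x I J x∉Y)

  x∉Rest : ∀ {k} → zero ∉ Rest k
  x∉Rest ()

  Rest⁺ : ∀ {k e} → e ∉ A k → suc e ∈ Rest k
  Rest⁺ e∉A = there (x∈p∩q⁺ (∈⊤ , x∉p⇒x∈∁p e∉A))

  x∉B+e : ∀ {k B e} → B ⊆ Rest k → e ∈ Rest k → zero ∉ B ∪ ⁅ e ⁆
  x∉B+e B⊆Rest e∈Rest p = x∉Rest (∪⁅⁆-⊆ B⊆Rest e∈Rest p)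

  Rest-avoids : ∀ {J k i e} → e ∈ Rest k → e ∈ ext A J i → i ≢ k
  Rest-avoids {k = k} {e = suc e} (there e∈) (there e∈A) refl =
    x∈∁p⇒x∉p (proj₂ (x∈p∩q⁻ ⊤ (∁ (A k)) e∈)) e∈A

  maximal-any-I : ∀ I J {k B} → MaximalIn (ext A I) (Rest k) B → MaximalIn (ext A J) (Rest k) B
  maximal-any-I I J (ptB , B⊆Rest , maxB) =
    indep-without-x I J (λ p → x∉Rest (B⊆Rest p)) ptB , (λ {_} → B⊆Rest) ,
    λ e e∈Rest e∉B indep → maxB e e∈Rest e∉B (indep-without-x J I (x∉B+e B⊆Rest e∈Rest) indep)

  maximal-exists : ∀ k → DoubleNegation (Σ (Subset (suc n)) (MaximalIn (ext A ⊥) (Rest k)))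
  maximal-exists k =
    maximal-extension (ext A ⊥) (Rest k) (suc n) ⊥ (m≤m+n (suc n) _) (pt-∅ {S = ext A ⊥}) (λ p → ⊥-elim (∉⊥ p)) >>=
    λ { (B , _ , maxB) → pure (B , maxB) }

  N : Subset r → Fin r → SetMatroid (suc n)
  N I k = M[ ext A I ] ＼ lift (A k)

  Ground : Fin r → Subset (suc n)
  Ground k = ⊤ ∩ ∁ (lift (A k))

  Rest⊆Ground : ∀ {k e} → e ∈ Rest k → e ∈ Ground k
  Rest⊆Ground (there q) = there q

  Ground⇒Rest : ∀ {k e} → suc e ∈ Ground k → suc e ∈ Rest k
  Ground⇒Rest (there q) = there q

  -- A maximal B ⊆ E ∖ A_k with B ∪ {x} dependent would be a basis of
  -- N I k avoiding x.
  coloop⇒Coloop : ∀ I k → IsColoop (N I k) zero → Coloop I k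
  coloop⇒Coloop I k (_ , in-every-basis) B (ptB , B⊆Rest , maxB) ¬indep =
    x∉Rest (B⊆Rest (in-every-basis B basis))
    where
    B⊆ground : B ⊆ ground (N I k)
    B⊆ground p = Rest⊆Ground (B⊆Rest p)
    maximal : ∀ Y → Indep I Y → Y ⊆ ground (N I k) → B ⊆ Y → ∀ e → e ∈ Y → e ∈ B
    maximal Y indepY Y⊆G B⊆Y e e∈Y with e ∈? B
    ... | yes e∈B = e∈B
    maximal Y indepY Y⊆G B⊆Y zero e∈Y | no _ =
      ⊥-elim (¬indep (pt-hereditary {S = ext A I} (∪⁅⁆-⊆ B⊆Y e∈Y) indepY))
    maximal Y indepY Y⊆G B⊆Y (suc e) e∈Y | no e∉B =
      ⊥-elim (maxB (suc e) (Ground⇒Rest (Y⊆G e∈Y)) e∉B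
        (indep-without-x I ⊥ (x∉B+e B⊆Rest (Ground⇒Rest (Y⊆G e∈Y))) (pt-hereditary {S = ext A I} (∪⁅⁆-⊆ B⊆Y e∈Y) indepY)))
    basis : IsBasis (N I k) B
    basis = (indep-without-x ⊥ I (λ p → x∉Rest (B⊆Rest p)) ptB , (λ {_} → B⊆ground)) , (λ {_} → B⊆ground) ,
            λ Y (indepY , Y⊆G) B⊆Y {e} e∈Y → maximal Y indepY Y⊆G B⊆Y e e∈Y

  -- A basis of N I k without x is maximal inside E ∖ A_k, so adding x
  -- would give a larger independent set.
  Coloop⇒coloop : ∀ {I k} → Coloop I k → IsColoop (N I k) zero
  Coloop⇒coloop {I} {k} c = here , λ B basis → decidable-stable (zero ∈? B) (x∈basis B basis)
    where
    x∈basis : ∀ B → IsBasis (N I k) B → DoubleNegation (zero ∈ B)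
    x∈basis B ((indepB , _) , B⊆G , maxl) x∉B =
      c B maxB (λ indep → x∉B (maxl (B ∪ ⁅ zero ⁆) (indep , ∪⁅⁆-⊆ B⊆G here) (∈∪⁅⁆-old {u = zero}) (∈∪⁅⁆-new refl)))
      where
      B⊆Rest : B ⊆ Rest k
      B⊆Rest {zero} p = ⊥-elim (x∉B p)
      B⊆Rest {suc e} p = Ground⇒Rest (B⊆G p)
      maxB : MaximalIn (ext A ⊥) (Rest k) B
      maxB = indep-without-x I ⊥ x∉B indepB , (λ {_} → B⊆Rest) , λ e e∈Rest e∉B indep →
        e∉B (maxl (B ∪ ⁅ e ⁆) (indep-without-x ⊥ I (x∉B+e B⊆Rest e∈Rest) indep , ∪⁅⁆-⊆ B⊆G (Rest⊆Ground e∈Rest))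
                  ∈∪⁅⁆-old (∈∪⁅⁆-new refl))

  Coloop-mono : ∀ {I J k} → I ⊆ J → Coloop I k → Coloop J k
  Coloop-mono I⊆J c B maxB = c B maxB >>= λ indep → pure (indep-mono I⊆J indep)

  -- Nothing is a coloop for I = ∅: x lies in no set of A^∅.
  ¬Coloop-∅ : ∀ {k} → ¬ Coloop ⊥ k
  ¬Coloop-∅ {k} c = maximal-exists k λ { (B , maxB) → c B maxB x-unmatched }
    where
    x-unmatched : ∀ {B} → ¬ Indep ⊥ (B ∪ ⁅ zero ⁆)
    x-unmatched (_ , fits , _) = ∉⊥ (x∈A^I⇒ ⊥ (fits zero (∈∪⁅⁆-new refl)))

  -- A single i ∈ I already witnesses Coloop I k: take i to be the index
  -- of x in one matching of B₀ ∪ {x}; all other maximal B behave alike.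
  Coloop-witness : ∀ {I k} → Coloop I k → DoubleNegation (∃ λ i → i ∈ I × Coloop ⁅ i ⁆ k)
  Coloop-witness {I} {k} c =
    maximal-exists k >>= λ { (B₀ , maxB₀) → c B₀ maxB₀ >>= λ indep → pure (witness maxB₀ indep) }
    where
    witness : ∀ {B₀} → MaximalIn (ext A ⊥) (Rest k) B₀ → Indep I (B₀ ∪ ⁅ zero ⁆) → ∃ λ i → i ∈ I × Coloop ⁅ i ⁆ k
    witness {B₀} maxB₀ indep@(φ , _) = i , x∈A^I⇒ I (fits mf zero (∈∪⁅⁆-new refl)) , λ B maxB →
      pure (maximal-extends-alike (ext A ⁅ i ⁆) (Rest k) x∉Rest (maximal-any-I ⊥ ⁅ i ⁆ maxB₀) (maximal-any-I ⊥ ⁅ i ⁆ maxB) indep-i)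
      where
      f : Fin (suc n) → Fin r
      f = proj₁ (pt⇒matching {S = ext A I} (φ zero (∈∪⁅⁆-new refl)) indep)
      mf : Matching (ext A I) (B₀ ∪ ⁅ zero ⁆) Unconstrained f
      mf = proj₂ (pt⇒matching {S = ext A I} (φ zero (∈∪⁅⁆-new refl)) indep)
      i : Fin r
      i = f zero
      into-A^i : ∀ e → e ∈ B₀ ∪ ⁅ zero ⁆ → Unit → e ∈ ext A I (f e) → e ∈ ext A ⁅ i ⁆ (f e)
      into-A^i zero _ _ _ = x∈A^I⇐ (x∈⁅x⁆ i)
      into-A^i (suc e) _ _ p = there (drop-there p)
      indep-i : Indep ⁅ i ⁆ (B₀ ∪ ⁅ zero ⁆)
      indep-i = matching⇒pt (transfer {S′ = ext A ⁅ i ⁆} into-A^i mf)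

  -- If adding k to I creates no new independent sets, then x is a coloop:
  -- in A^{I ∪ {k}} the element x can take the free index k.
  absorb⇒Coloop : ∀ {I k} → (∀ Y → Indep (I ∪ ⁅ k ⁆) Y → DoubleNegation (Indep I Y)) → Coloop I k
  absorb⇒Coloop {I} {k} absorb B (ptB , B⊆Rest , _) = absorb (B ∪ ⁅ zero ⁆) (matching⇒pt x↦k)
    where
    f : Fin (suc n) → Fin r
    f = proj₁ (pt⇒matching {S = ext A ⊥} k ptB)
    mf : Matching (ext A ⊥) B Unconstrained f
    mf = proj₂ (pt⇒matching {S = ext A ⊥} k ptB)
    mf′ : Matching (ext A (I ∪ ⁅ k ⁆)) B Unconstrained f
    mf′ = transfer (λ e p _ → A^-off-x ⊥ (I ∪ ⁅ k ⁆) (λ q → x∉Rest (B⊆Rest q)) e (f e) p) mf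
    x↦k : Matching (ext A (I ∪ ⁅ k ⁆)) (B ∪ ⁅ zero ⁆) Unconstrained (redirect f zero k)
    x↦k = extend mf′ (x∈A^I⇐ (∈∪⁅⁆-new {X = I} refl)) tt (λ e p → Rest-avoids {J = ⊥} (B⊆Rest p) (fits mf e p))
            (λ e p e≢x → [ id , (λ e≡x → ⊥-elim (e≢x e≡x)) ] (∈∪⁅⁆-case p))

  -- Core of "Coloop I k implies M[A^{I ∪ {k}}] = M[A^I]" for k ∉ I: let Y be
  -- matched by g in A^{I ∪ {k}} with x sent to k, and let B ⊆ E ∖ A_k
  -- contain Y ∩ (E ∖ A_k) with B ∪ {x} independent in A^I.  The exchange
  -- lemma for B ∪ {x} against Y − x (both avoiding k) rematches Y in A^I,
  -- moving at most one element of Y ∩ A_k onto the index k.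
  rematch : ∀ {I k Y g B} → k ∉ I → zero ∈ Y → g zero ≡ k →
            Matching (ext A (I ∪ ⁅ k ⁆)) Y Unconstrained g →
            B ⊆ Rest k → Y ∩ Rest k ⊆ B → Indep I (B ∪ ⁅ zero ⁆) → Indep I Y
  rematch {I} {k} {Y} {g} {B} k∉I x∈Y gx≡k mg B⊆Rest Y∩Rest⊆B indepB =
    finish (exchange (suc ∣ P ∣) ≤-refl mf′ mg′ {u = zero} (∈∪⁅⁆-new refl) (λ p → proj₂ (∈-⁻ {t = zero} p) refl))
    where
    open Exchange (ext A (I ∪ ⁅ k ⁆)) using (Result; exchange)
    P : Subset (suc n)
    P = B ∪ ⁅ zero ⁆
    f : Fin (suc n) → Fin r
    f = proj₁ (pt⇒matching {S = ext A I} k indepB)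
    mf : Matching (ext A I) P Unconstrained f
    mf = proj₂ (pt⇒matching {S = ext A I} k indepB)
    -- B avoids A_k, and x cannot use k ∉ I.
    f-avoids-k : ∀ e → e ∈ P → f e ≢ k
    f-avoids-k e p with ∈∪⁅⁆-case {X = B} {u = zero} p
    ... | inj₁ e∈B = Rest-avoids {J = I} (B⊆Rest e∈B) (fits mf e p)
    ... | inj₂ refl = λ fx≡k → k∉I (subst (_∈ I) fx≡k (x∈A^I⇒ I (fits mf zero p)))
    mf′ : Matching (ext A (I ∪ ⁅ k ⁆)) P (_≢ k) f
    mf′ = constrain (transfer (λ e _ _ → A^-mono {I} {I ∪ ⁅ k ⁆} (p⊆p∪q ⁅ k ⁆) e (f e)) mf) f-avoids-k
    -- g sends x to k, so the rest of Y avoids k.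
    mg′ : Matching (ext A (I ∪ ⁅ k ⁆)) (Y - zero) (_≢ k) g
    mg′ = constrain (restrict mg (λ p → proj₁ (∈-⁻ {t = zero} p)))
            (λ e p gk → proj₂ (∈-⁻ {t = zero} p) (injective mg e zero (proj₁ (∈-⁻ {t = zero} p)) x∈Y (trans gk (sym gx≡k))))
    into-A^I : ∀ {X h} → Matching (ext A (I ∪ ⁅ k ⁆)) X (_≢ k) h → Matching (ext A I) X (_≢ k) h
    into-A^I {h = h} = transfer (λ e _ h≢k → A^-off-k I e (h e) h≢k)
    -- An element of Y swapped out of P is not in Y ∩ (E ∖ A_k) ⊆ B.
    swapped∈A_k : ∀ t → suc t ∈ Y → suc t ∉ P → t ∈ A k
    swapped∈A_k t t∈Y t∉P with t ∈? A k
    ... | yes t∈A = t∈A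
    ... | no t∉A = ⊥-elim (t∉P (∈∪⁅⁆-old {u = zero} (Y∩Rest⊆B (x∈p∩q⁺ (t∈Y , Rest⁺ t∉A)))))
    finish : Result P (Y - zero) (_≢ k) zero → Indep I Y
    finish (inj₁ (_ , mh)) = matching⇒pt (restrict (into-A^I mh) (∈-swap {t = zero}))
    finish (inj₂ (zero , x∈Y-x , _)) = ⊥-elim (proj₂ (∈-⁻ {t = zero} x∈Y-x) refl)
    finish (inj₂ (suc t , t∈Y-x , t∉P , (h , mh) , _)) =
      matching⇒pt (extend (relax {C′ = Unconstrained} (λ _ _ → tt) (into-A^I mh))
                          (there (swapped∈A_k t (proj₁ (∈-⁻ {t = zero} t∈Y-x)) t∉P)) tt (λ e p → allowed mh e p)
                          (λ e p e≢t → x∈p∧x≢y⇒x∈p-y (∈-swap {t = zero} p) e≢t))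

  -- For k ∉ I, Coloop I k makes every independent set of A^{I ∪ {k}}
  -- independent in A^I: only a matching sending x to k needs repair,
  -- done by rematch with a maximal B ⊇ Y ∩ (E ∖ A_k).
  Coloop⇒absorb : ∀ {I k} → k ∉ I → Coloop I k → ∀ Y → Indep (I ∪ ⁅ k ⁆) Y → DoubleNegation (Indep I Y)
  Coloop⇒absorb {I} {k} k∉I c Y indepY@(φ , _) with zero ∈? Y
  ... | no x∉Y = pure (indep-without-x (I ∪ ⁅ k ⁆) I x∉Y indepY)
  ... | yes x∈Y with pt⇒matching {S = ext A (I ∪ ⁅ k ⁆)} (φ zero x∈Y) indepY
  ...   | g , mg with g zero ≟ k
  ...     | no gx≢k = pure (matching⇒pt (transfer {S′ = ext A I} x-elsewhere mg))
    where
    x-elsewhere : ∀ e → e ∈ Y → Unit → e ∈ ext A (I ∪ ⁅ k ⁆) (g e) → e ∈ ext A I (g e)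
    x-elsewhere zero _ _ p = A^-off-k I zero (g zero) gx≢k p
    x-elsewhere (suc e) _ _ p = there (drop-there p)
  ...     | yes gx≡k =
    maximal-extension (ext A ⊥) (Rest k) (suc n) (Y ∩ Rest k) (m≤m+n (suc n) _) indep-Y∩Rest (λ p → proj₂ (x∈p∩q⁻ Y (Rest k) p)) >>=
    λ { (B , Y∩Rest⊆B , maxB) → c B maxB >>= λ indepB →
    pure (rematch k∉I x∈Y gx≡k mg (proj₁ (proj₂ maxB)) Y∩Rest⊆B indepB) }
    where
    indep-Y∩Rest : Indep ⊥ (Y ∩ Rest k)
    indep-Y∩Rest = indep-without-x (I ∪ ⁅ k ⁆) ⊥ (λ p → x∉Rest (proj₂ (x∈p∩q⁻ Y (Rest k) p)))
                     (pt-hereditary {S = ext A (I ∪ ⁅ k ⁆)} (p∩q⊆p Y (Rest k)) indepY)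

  -- Coloop is transitive on singletons: route A^{i,k} through A^{i,j,k}.
  Coloop-trans : ∀ {i j k} → j ∉ ⁅ i ⁆ → k ∉ ⁅ i ⁆ ∪ ⁅ j ⁆ → Coloop ⁅ i ⁆ j → Coloop ⁅ j ⁆ k → Coloop ⁅ i ⁆ k
  Coloop-trans {i} {j} {k} j∉ k∉ cij cjk = absorb⇒Coloop {I = ⁅ i ⁆} {k = k} λ Y indep →
    Coloop⇒absorb {I = ⁅ i ⁆ ∪ ⁅ j ⁆} k∉ (Coloop-mono (q⊆p∪q ⁅ i ⁆ ⁅ j ⁆) cjk) Y (indep-mono ik⊆ijk indep) >>=
    Coloop⇒absorb {I = ⁅ i ⁆} j∉ cij Y
    where
    ik⊆ijk : ⁅ i ⁆ ∪ ⁅ k ⁆ ⊆ (⁅ i ⁆ ∪ ⁅ j ⁆) ∪ ⁅ k ⁆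
    ik⊆ijk p = [ (λ q → ∈∪⁅⁆-old (p⊆p∪q ⁅ j ⁆ q)) , ∈∪⁅⁆-new ] (∈∪⁅⁆-case p)

-- The closure operator σ_A and its closed sets

module Closure {n r : ℕ} (A : SetSystem n r) where
  open Coloops A

  Coloop⇒σ : ∀ {I k} → Coloop I k → σ A I k
  Coloop⇒σ {I} {k} c with k ∈? I
  ... | yes k∈I = inj₁ k∈I
  ... | no k∉I = inj₂ (k∉I , Coloop⇒coloop {I} c)

  closed-Coloop : ∀ {I k} → Closed A I → Coloop I k → k ∈ I
  closed-Coloop cI c = cI _ (Coloop⇒σ c)

  σ-monotone : ∀ {I J} → I ⊆ J → ∀ k → σ A I k → σ A J k
  σ-monotone I⊆J k (inj₁ k∈I) = inj₁ (I⊆J k∈I)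
  σ-monotone {I} I⊆J k (inj₂ (_ , col)) = Coloop⇒σ (Coloop-mono I⊆J (coloop⇒Coloop I k col))

  -- σ_A(σ_A(I)) ⊆ σ_A(I): a coloop for K = σ_A(I) is witnessed by some
  -- j ∈ K, and j itself is witnessed by some i ∈ I; chain by transitivity.
  σ-idempotent : ∀ {I K} → IsSigmaOf A I K → ∀ k → σ A K k → σ A I k
  σ-idempotent sig k (inj₁ k∈K) = Equivalence.to (sig k) k∈K
  σ-idempotent {I} {K} sig k (inj₂ (k∉K , col)) =
    Coloop⇒σ (Coloop-stable {I} (Coloop-witness (coloop⇒Coloop K k col) >>= via-K))
    where
    I⊆K : I ⊆ K
    I⊆K {i} i∈I = Equivalence.from (sig i) (inj₁ i∈I)
    ∉⁅⁆ : ∀ {X : Subset r} {a b} → a ∉ X → b ∈ X → a ∉ ⁅ b ⁆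
    ∉⁅⁆ a∉X b∈X a∈⁅b⁆ = a∉X (⁅⁆⊆ b∈X a∈⁅b⁆)
    via-K : (∃ λ j → j ∈ K × Coloop ⁅ j ⁆ k) → DoubleNegation (Coloop I k)
    via-K (j , j∈K , cjk) with j ∈? I | Equivalence.to (sig j) j∈K
    ... | yes j∈I | _ = pure (Coloop-mono (⁅⁆⊆ j∈I) cjk)
    ... | no j∉I | inj₁ j∈I = ⊥-elim (j∉I j∈I)
    ... | no j∉I | inj₂ (_ , col-j) = Coloop-witness (coloop⇒Coloop I j col-j) >>= λ { (i , i∈I , cij) →
      pure (Coloop-mono (⁅⁆⊆ i∈I)
        (Coloop-trans (∉⁅⁆ j∉I i∈I)
                      (λ p → [ ∉⁅⁆ (λ k∈I → k∉K (I⊆K k∈I)) i∈I , ∉⁅⁆ k∉K j∈K ] (x∈p∪q⁻ ⁅ i ⁆ ⁅ j ⁆ p))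
                      cij cjk)) }

  -- A coloop for I ∪ J is witnessed inside I or inside J.
  ∪-closed : ∀ {I J} → Closed A I → Closed A J → Closed A (I ∪ J)
  ∪-closed _ _ k (inj₁ k∈I∪J) = k∈I∪J
  ∪-closed {I} {J} cI cJ k (inj₂ (_ , col)) =
    decidable-stable (k ∈? (I ∪ J)) (Coloop-witness (coloop⇒Coloop (I ∪ J) k col) >>= λ { (i , i∈I∪J , cik) →
      pure (x∈p∪q⁺ (map (λ i∈I → closed-Coloop cI (Coloop-mono (⁅⁆⊆ i∈I) cik))
                                 (λ i∈J → closed-Coloop cJ (Coloop-mono (⁅⁆⊆ i∈J) cik))
                                 (x∈p∪q⁻ I J i∈I∪J))) })

  ∪-isJoin : ∀ {I J} → Closed A I → Closed A J → IsJoinIn A I J (I ∪ J)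
  ∪-isJoin {I} {J} cI cJ = ∪-closed cI cJ , (λ {_} → p⊆p∪q J) , (λ {_} → q⊆p∪q I J) ,
    λ K _ I⊆K J⊆K p → [ I⊆K , J⊆K ] (x∈p∪q⁻ I J p)

  -- Closed sets are closed under ∩ by monotonicity of σ_A.
  ∩-isMeet : ∀ {I J} → Closed A I → Closed A J → IsMeetIn A I J (I ∩ J)
  ∩-isMeet {I} {J} cI cJ =
    (λ k s → x∈p∩q⁺ (cI k (σ-monotone (p∩q⊆p I J) k s) , cJ k (σ-monotone (p∩q⊆q I J) k s))) ,
    (λ {_} → p∩q⊆p I J) , (λ {_} → p∩q⊆q I J) , λ K _ K⊆I K⊆J p → x∈p∩q⁺ (K⊆I p , K⊆J p)

  -- ∅ is closed as nothing is a coloop for it; [r] trivially.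
  ∅-closed : Closed A ⊥
  ∅-closed k (inj₁ k∈∅) = k∈∅
  ∅-closed k (inj₂ (_ , col)) = ⊥-elim (¬Coloop-∅ (coloop⇒Coloop ⊥ k col))

  full-closed : Closed A ⊤
  full-closed k _ = ∈⊤

theorem3p1 : (n r : ℕ) (A : SetSystem n r) → HasRank A r →
    ((I : Subset r) (k : Fin r) → k ∈ I → σ A I k) ×
    ((I J : Subset r) → I ⊆ J → (k : Fin r) → σ A I k → σ A J k) ×
    ((I K : Subset r) → IsSigmaOf A I K → (k : Fin r) → (σ A K k ⇔ σ A I k)) ×
    ((I J : Subset r) → Closed A I → Closed A J → IsJoinIn A I J (I ∪ J)) ×
    ((I J : Subset r) → Closed A I → Closed A J → IsMeetIn A I J (I ∩ J)) ×
    ((I J K : Subset r) → Closed A I → Closed A J → Closed A K →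
      I ∩ (J ∪ K) ≡ (I ∩ J) ∪ (I ∩ K)) ×
    Closed A ⊥ × Closed A ⊤
theorem3p1 n r A _ =
  (λ I k → inj₁) ,
  (λ I J → σ-monotone) ,
  (λ I K sig k → mk⇔ (σ-idempotent sig k) (λ s → inj₁ (Equivalence.from (sig k) s))) ,
  (λ I J → ∪-isJoin) ,
  (λ I J → ∩-isMeet) ,
  (λ I J K _ _ _ → ∩-distribˡ-∪ I J K) ,
  ∅-closed ,
  full-closed
  where open Closure A
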